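{- For every formula $F\in\mathcal{L}$, if $F$ is valid in every neighbourhood model, then $F$ is derivable in the axiom system of $\mathbb{PCL}$.
   Context: Formulas of $\mathcal{L}$ are built from propositional atoms $p$ and $\bot$ by $\wedge,\vee,\rightarrow$ and a binary conditional $>$; $\neg A$ abbreviates $A\rightarrow\bot$, $\top$ abbreviates $\neg\bot$. A neighbourhood model is a triple $\langle W,N,\llbracket\cdot\rrbracket\rangle$ with $W$ non-empty, $N:W\to\mathcal{P}(\mathcal{P}(W))$, $\llbracket\cdot\rrbracket$ a valuation of atoms, such that every $\alpha\in N(x)$ is non-empty. Forcing: atoms via the valuation, $\bot$ never, Boolean connectives classically; $\alpha\Vdash^\exists A$ means some world of $\alpha$ forces $A$, $\alpha\Vdash^\forall A$ means all worlds of $\alpha$ force $A$; $x\Vdash A>B$ iff for every $\alpha\in N(x)$ with $\alpha\Vdash^\exists A$ there is $\beta\in N(x)$ with $\beta\subseteq\alpha$, $\beta\Vdash^\exists A$ and $\beta\Vdash^\forall A\rightarrow B$. Valid in a model = forced at every world. The axiom system of $\mathbb{PCL}$: classical propositional tautologies and modus ponens, the rules (RCEA) from $A\leftrightarrow B$ infer $(A>C)\leftrightarrow(B>C)$ and (RCK) from $A\rightarrow B$ infer $(C>A)\rightarrow(C>B)$, and the axioms (ID) $A>A$, (R-And) $(A>B)\wedge(A>C)\rightarrow(A>(B\wedge C))$, (CM) $(A>B)\wedge(A>C)\rightarrow((A\wedge B)>C)$, (OR) $(A>C)\wedge(B>C)\rightarrow((A\vee B)>C)$. -}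

module Defs where

open import Data.Nat using (ℕ)
open import Data.Bool using (Bool; true; false; _∧_; _∨_; not)
open import Data.Product using (Σ; _×_; ∃)
open import Data.Sum using (_⊎_)
open import Data.Empty using (⊥)
open import Relation.Binary.PropositionalEquality using (_≡_)
open import Level using (suc; zero)

infixr 30 _∧'_
infixr 25 _∨'_
infixr 20 _⇒_
infixr 22 _▷_
data Fm : Set where
  atom : ℕ → Fm
  falsum : Fm
  _∧'_ _∨'_ _⇒_ _▷_ : Fm → Fm → Fm

¬' : Fm → Fm
¬' A = A ⇒ falsum

⊤' : Fm
⊤' = ¬' falsum

_⇔_ : Fm → Fm → Fm
A ⇔ B = (A ⇒ B) ∧' (B ⇒ A)

-- Boolean evaluation, treating atoms and conditionals A > B as propositional
-- variables whose values are given by v.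
eval : (Fm → Bool) → Fm → Bool
eval v (atom i) = v (atom i)
eval v falsum = false
eval v (A ∧' B) = eval v A ∧ eval v B
eval v (A ∨' B) = eval v A ∨ eval v B
eval v (A ⇒ B) = not (eval v A) ∨ eval v B
eval v (A ▷ B) = v (A ▷ B)

Tautology : Fm → Set
Tautology F = (v : Fm → Bool) → eval v F ≡ true

data ⊢_ : Fm → Set where
  taut  : ∀ {A} → Tautology A → ⊢ A
  mp    : ∀ {A B} → ⊢ (A ⇒ B) → ⊢ A → ⊢ B
  rcea  : ∀ {A B C} → ⊢ (A ⇔ B) → ⊢ ((A ▷ C) ⇔ (B ▷ C))
  rck   : ∀ {A B C} → ⊢ (A ⇒ B) → ⊢ ((C ▷ A) ⇒ (C ▷ B))
  id    : ∀ {A} → ⊢ (A ▷ A)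
  r-and : ∀ {A B C} → ⊢ (((A ▷ B) ∧' (A ▷ C)) ⇒ (A ▷ (B ∧' C)))
  cm    : ∀ {A B C} → ⊢ (((A ▷ B) ∧' (A ▷ C)) ⇒ ((A ∧' B) ▷ C))
  or    : ∀ {A B C} → ⊢ (((A ▷ C) ∧' (B ▷ C)) ⇒ ((A ∨' B) ▷ C))

-- Neighbourhood models. Subsets of W are characteristic functions W → Bool
-- (P(W) ≅ W → Bool classically; this keeps N(x) ⊆ P(W) small);
-- N x α means α ∈ N(x).
record Model : Set₁ where
  field
    W        : Set
    w₀       : W
    N        : W → (W → Bool) → Set
    V        : W → ℕ → Set
    nonempty : ∀ {x α} → N x α → Σ W (λ y → α y ≡ true)

module _ (M : Model) where
  open Model M

  _∈_ : W → (W → Bool) → Set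
  y ∈ α = α y ≡ true

  _⊆_ : (W → Bool) → (W → Bool) → Set
  β ⊆ α = ∀ y → y ∈ β → y ∈ α

  mutual
    _⊩_ : W → Fm → Set
    x ⊩ atom i = V x i
    x ⊩ falsum = ⊥
    x ⊩ (A ∧' B) = (x ⊩ A) × (x ⊩ B)
    x ⊩ (A ∨' B) = (x ⊩ A) ⊎ (x ⊩ B)
    x ⊩ (A ⇒ B) = x ⊩ A → x ⊩ B
    x ⊩ (A ▷ B) =
      ∀ α → N x α → α ⊩∃ A →
      Σ (W → Bool) λ β → N x β × β ⊆ α × β ⊩∃ A × (∀ y → y ∈ β → y ⊩ A → y ⊩ B)

    _⊩∃_ : (W → Bool) → Fm → Set
    α ⊩∃ A = Σ W λ y → y ∈ α × y ⊩ A

    _⊩∀_ : (W → Bool) → Fm → Set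
    α ⊩∀ A = ∀ y → y ∈ α → y ⊩ A

  ValidIn : Fm → Set
  ValidIn F = ∀ x → x ⊩ F

Valid : Fm → Set₁
Valid F = (M : Model) → ValidIn M F

module Submission where

-- A canonical neighbourhood model. Its worlds are pairs ⟨ Y , A ⟩ of a maximal consistent set Y
-- and a formula A. Relative to a maximal consistent set X, ⟨ Y , A ⟩ is normal when Y contains
-- every B with A > B ∈ X, and v ≺ u when formula v is at least as normal as formula u, that is
-- (formula v ∨ formula u) > formula v ∈ X, while formula u ∉ theory v; (CM), (OR) and cut make ≺
-- transitive on normal worlds. The neighbourhoods of a world with theory X are the ≼-cones of
-- normal worlds, and the truth lemma w ⊩ F ⇔ F ∈ theory w reduces for a conditional to two facts:
-- if C > D ∈ X, every cone containing a C-world contains a C-world whose own cone satisfies C → D;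
-- if C > D ∉ X, the cone of a normal C-world without D is a counterexample. Maximal consistent
-- sets come from Lindenbaum's lemma along an enumeration of formulas, excluded middle deciding
-- each step.

open import Defs hiding (_∈_; _⊆_)
open import Axiom.ExcludedMiddle using (ExcludedMiddle)

open import Data.Bool using (Bool; true; false; T; _∧_; _∨_; not)
open import Data.Bool.Properties using (T-∧; T-≡)
open import Data.Empty using (⊥; ⊥-elim)
open import Data.Fin using (Fin; zero; suc)
open import Data.List using (List; []; _∷_; _++_; concatMap; cartesianProductWith)
open import Data.List.Membership.Propositional using (_∈_)
open import Data.List.Membership.Propositional.Properties
  using (∈-++⁺ˡ; ∈-++⁺ʳ; ∈-concatMap⁺; ∈-cartesianProductWith⁺)
open import Data.List.Relation.Unary.All using (All; []; _∷_) renaming (map to All-map)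
open import Data.List.Relation.Unary.All.Properties using (++⁺)
open import Data.List.Relation.Unary.Any using (here; there) renaming (map to Any-map)
open import Data.Nat using (ℕ; zero; suc; _+_; _⊔_; _≤′_; ≤′-refl; ≤′-step)
open import Data.Nat.Properties using (m≤m⊔n; m≤n⊔m; ≤⇒≤′)
open import Data.Product using (Σ; _×_; _,_; proj₁; proj₂)
open import Data.Sum using (_⊎_; inj₁; inj₂) renaming (map to ⊎-map)
open import Data.Vec using (Vec; []; _∷_; lookup; map)
open import Data.Vec.Properties using (lookup-map)
open import Function using (_∘_)
open import Function.Bundles using (Equivalence)
open import Level using (0ℓ)
open import Relation.Binary.PropositionalEquality using (_≡_; _≗_; refl; sym; trans; cong₂)
open import Relation.Nullary using (¬_; Dec; yes; no; does)
open import Relation.Nullary.Decidable using (dec-true)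
open import Relation.Unary using (Pred; _⊆_; _∪_; ｛_｝; ∅)

private variable
  m n : ℕ
  A B C D F H : Fm
  Δ Γ : Pred Fm 0ℓ

-- Propositional tautologies by truth tables

infixr 30 _∧ˢ_
infixr 25 _∨ˢ_
infixr 20 _⇒ˢ_

data Schema (n : ℕ) : Set where
  var            : Fin n → Schema n
  ⊥ˢ             : Schema n
  _∧ˢ_ _∨ˢ_ _⇒ˢ_ : Schema n → Schema n → Schema n

`A : Schema (suc n)
`A = var zero

`B : Schema (2 + n)
`B = var (suc zero)

`C : Schema (3 + n)
`C = var (suc (suc zero))

`D : Schema (4 + n)
`D = var (suc (suc (suc zero)))

`E : Schema (5 + n)
`E = var (suc (suc (suc (suc zero))))

⊤ˢ : Schema n
⊤ˢ = ⊥ˢ ⇒ˢ ⊥ˢ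

¬ˢ : Schema n → Schema n
¬ˢ s = s ⇒ˢ ⊥ˢ

_⇔ˢ_ : Schema n → Schema n → Schema n
s ⇔ˢ t = (s ⇒ˢ t) ∧ˢ (t ⇒ˢ s)

infix 40 _[_]
_[_] : Schema n → Vec Fm n → Fm
var i    [ σ ] = lookup σ i
⊥ˢ       [ σ ] = falsum
(s ∧ˢ t) [ σ ] = s [ σ ] ∧' t [ σ ]
(s ∨ˢ t) [ σ ] = s [ σ ] ∨' t [ σ ]
(s ⇒ˢ t) [ σ ] = s [ σ ] ⇒ t [ σ ]

truthValue : Schema n → Vec Bool n → Bool
truthValue (var i)  ρ = lookup ρ i
truthValue ⊥ˢ       ρ = false
truthValue (s ∧ˢ t) ρ = truthValue s ρ ∧ truthValue t ρ
truthValue (s ∨ˢ t) ρ = truthValue s ρ ∨ truthValue t ρ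
truthValue (s ⇒ˢ t) ρ = not (truthValue s ρ) ∨ truthValue t ρ

eval-[] : ∀ v (s : Schema n) σ → eval v (s [ σ ]) ≡ truthValue s (map (eval v) σ)
eval-[] v (var i)  σ = sym (lookup-map i (eval v) σ)
eval-[] v ⊥ˢ       σ = refl
eval-[] v (s ∧ˢ t) σ = cong₂ _∧_ (eval-[] v s σ) (eval-[] v t σ)
eval-[] v (s ∨ˢ t) σ = cong₂ _∨_ (eval-[] v s σ) (eval-[] v t σ)
eval-[] v (s ⇒ˢ t) σ = cong₂ (λ a b → not a ∨ b) (eval-[] v s σ) (eval-[] v t σ)

allRows : (Vec Bool n → Bool) → Bool
allRows {zero}  f = f []
allRows {suc n} f = allRows (λ ρ → f (true ∷ ρ)) ∧ allRows (λ ρ → f (false ∷ ρ))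

allRows-sound : (f : Vec Bool n → Bool) → T (allRows f) → ∀ ρ → T (f ρ)
allRows-sound {zero}  f ok [] = ok
allRows-sound {suc n} f ok (true ∷ ρ)  = allRows-sound _ (proj₁ (Equivalence.to T-∧ ok)) ρ
allRows-sound {suc n} f ok (false ∷ ρ) = allRows-sound _ (proj₂ (Equivalence.to T-∧ ok)) ρ

IsTautology : Schema n → Set
IsTautology s = T (allRows (truthValue s))

-- The implicit truth-table check normalises to ⊤ for a tautological schema, so it is always inferred.
tautology : (s : Schema n) (σ : Vec Fm n) {_ : IsTautology s} → ⊢ s [ σ ]
tautology s σ {ok} = taut λ v →
  trans (eval-[] v s σ) (Equivalence.to T-≡ (allRows-sound (truthValue s) ok (map (eval v) σ)))

mp₂ : ⊢ (A ⇒ B ⇒ C) → ⊢ A → ⊢ B → ⊢ C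
mp₂ p q r = mp (mp p q) r

-- Derivability from hypotheses

⋀ : List Fm → Fm
⋀ []      = ⊤'
⋀ (A ∷ L) = A ∧' ⋀ L

⋀-++ : ∀ L M → ⊢ (⋀ (L ++ M) ⇒ ⋀ L ∧' ⋀ M)
⋀-++ []      M = tautology (`A ⇒ˢ ⊤ˢ ∧ˢ `A) (⋀ M ∷ [])
⋀-++ (B ∷ L) M = mp (tautology ((`A ⇒ˢ `B ∧ˢ `C) ⇒ˢ `D ∧ˢ `A ⇒ˢ (`D ∧ˢ `B) ∧ˢ `C)
                               (⋀ (L ++ M) ∷ ⋀ L ∷ ⋀ M ∷ B ∷ []))
                    (⋀-++ L M)

infix 4 _⊢ₕ_
_⊢ₕ_ : Pred Fm 0ℓ → Fm → Set
Δ ⊢ₕ F = Σ (List Fm) λ L → All Δ L × ⊢ (⋀ L ⇒ F)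

⊢ₕ-theorem : ⊢ F → Δ ⊢ₕ F
⊢ₕ-theorem {F} p = [] , [] , mp (tautology (`A ⇒ˢ ⊤ˢ ⇒ˢ `A) (F ∷ [])) p

⊢ₕ-hyp : Δ F → Δ ⊢ₕ F
⊢ₕ-hyp {F = F} δ = F ∷ [] , δ ∷ [] , tautology (`A ∧ˢ ⊤ˢ ⇒ˢ `A) (F ∷ [])

∅-⊢ₕ : ∅ ⊢ₕ F → ⊢ F
∅-⊢ₕ ([] , [] , ⊤⇒F) = mp ⊤⇒F (tautology ⊤ˢ [])

⊢ₕ-mono : Δ ⊆ Γ → Δ ⊢ₕ F → Γ ⊢ₕ F
⊢ₕ-mono Δ⊆Γ (L , δs , p) = L , All-map Δ⊆Γ δs , p

⊢ₕ-mp : Δ ⊢ₕ (A ⇒ B) → Δ ⊢ₕ A → Δ ⊢ₕ B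
⊢ₕ-mp {A = A} {B} (L , δs , p) (M , εs , q) =
  L ++ M , ++⁺ δs εs ,
  mp₂ (mp (tautology ((`A ⇒ˢ `B ∧ˢ `C) ⇒ˢ (`B ⇒ˢ `D ⇒ˢ `E) ⇒ˢ (`C ⇒ˢ `D) ⇒ˢ `A ⇒ˢ `E)
                     (⋀ (L ++ M) ∷ ⋀ L ∷ ⋀ M ∷ A ∷ B ∷ []))
          (⋀-++ L M))
      p q

split-hyp : ∀ L → All (Δ ∪ ｛ H ｝) L → Σ (List Fm) λ L′ → All Δ L′ × ⊢ (H ∧' ⋀ L′ ⇒ ⋀ L)
split-hyp {H = H} [] [] = [] , [] , tautology (`A ∧ˢ ⊤ˢ ⇒ˢ ⊤ˢ) (H ∷ [])
split-hyp {H = H} (B ∷ L) (inj₁ δ ∷ hs) =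
  let L′ , δs , p = split-hyp L hs in
  B ∷ L′ , δ ∷ δs ,
  mp (tautology ((`A ∧ˢ `B ⇒ˢ `C) ⇒ˢ `A ∧ˢ (`D ∧ˢ `B) ⇒ˢ `D ∧ˢ `C) (H ∷ ⋀ L′ ∷ ⋀ L ∷ B ∷ [])) p
split-hyp {H = H} (B ∷ L) (inj₂ refl ∷ hs) =
  let L′ , δs , p = split-hyp L hs in
  L′ , δs , mp (tautology ((`A ∧ˢ `B ⇒ˢ `C) ⇒ˢ `A ∧ˢ `B ⇒ˢ `A ∧ˢ `C) (H ∷ ⋀ L′ ∷ ⋀ L ∷ [])) p

⊢ₕ-deduction : Δ ∪ ｛ H ｝ ⊢ₕ F → Δ ⊢ₕ (H ⇒ F)
⊢ₕ-deduction {H = H} {F} (L , hs , p) =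
  let L′ , δs , q = split-hyp L hs in
  L′ , δs , mp₂ (tautology ((`A ∧ˢ `B ⇒ˢ `C) ⇒ˢ (`C ⇒ˢ `D) ⇒ˢ `B ⇒ˢ `A ⇒ˢ `D) (H ∷ ⋀ L′ ∷ ⋀ L ∷ F ∷ [])) q p

⊢ₕ-cases : Δ ∪ ｛ H ｝ ⊢ₕ F → Δ ∪ ｛ ¬' H ｝ ⊢ₕ F → Δ ⊢ₕ F
⊢ₕ-cases {H = H} {F} p q =
  ⊢ₕ-mp (⊢ₕ-mp (⊢ₕ-theorem (tautology ((`A ⇒ˢ `B) ⇒ˢ (¬ˢ `A ⇒ˢ `B) ⇒ˢ `B) (H ∷ F ∷ [])))
               (⊢ₕ-deduction p))
        (⊢ₕ-deduction q)

-- Increasing chains and an enumeration of formulas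

module _ {X : Set} (S : ℕ → Pred X 0ℓ) (S-step : ∀ n → S n ⊆ S (suc n)) where

  chain-mono : m ≤′ n → S m ⊆ S n
  chain-mono ≤′-refl      = Function.id
  chain-mono (≤′-step m≤n) = S-step _ ∘ chain-mono m≤n

  chain-bound : ∀ {L} → All (λ x → Σ ℕ λ n → S n x) L → Σ ℕ λ N → All (S N) L
  chain-bound []              = 0 , []
  chain-bound ((n , s) ∷ ss) =
    let N , ss′ = chain-bound ss in
    n ⊔ N , chain-mono (≤⇒≤′ (m≤m⊔n n N)) s ∷ All-map (chain-mono (≤⇒≤′ (m≤n⊔m n N))) ss′

rank : Fm → ℕ
rank (atom i) = suc i
rank falsum   = 1
rank (A ∧' B) = suc (rank A ⊔ rank B)
rank (A ∨' B) = suc (rank A ⊔ rank B)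
rank (A ⇒ B)  = suc (rank A ⊔ rank B)
rank (A ▷ B)  = suc (rank A ⊔ rank B)

connectives : List (Fm → Fm → Fm)
connectives = _∧'_ ∷ _∨'_ ∷ _⇒_ ∷ _▷_ ∷ []

compounds : List Fm → List Fm
compounds Fs = concatMap (λ _⊗_ → cartesianProductWith _⊗_ Fs Fs) connectives

∈-compounds : ∀ {Fs _⊗_} → _⊗_ ∈ connectives → A ∈ Fs → B ∈ Fs → A ⊗ B ∈ compounds Fs
∈-compounds {Fs = Fs} ⊗∈ A∈ B∈ =
  ∈-concatMap⁺ (λ _⊕_ → cartesianProductWith _⊕_ Fs Fs)
               (Any-map (λ { refl → ∈-cartesianProductWith⁺ _ A∈ B∈ }) ⊗∈)

stage : ℕ → List Fm
stage zero    = []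
stage (suc n) = atom n ∷ falsum ∷ stage n ++ compounds (stage n)

stage-step : ∀ n → (_∈ stage n) ⊆ (_∈ stage (suc n))
stage-step n = there ∘ there ∘ ∈-++⁺ˡ

∈-stage-compound : ∀ {_⊗_} → _⊗_ ∈ connectives →
                   A ∈ stage (rank A) → B ∈ stage (rank B) → A ⊗ B ∈ stage (suc (rank A ⊔ rank B))
∈-stage-compound {A} {B} ⊗∈ A∈ B∈ =
  there (there (∈-++⁺ʳ (stage (rank A ⊔ rank B))
    (∈-compounds ⊗∈ (chain-mono (λ n → _∈ stage n) stage-step (≤⇒≤′ (m≤m⊔n (rank A) (rank B))) A∈)
                    (chain-mono (λ n → _∈ stage n) stage-step (≤⇒≤′ (m≤n⊔m (rank A) (rank B))) B∈))))

∈-stage : ∀ F → F ∈ stage (rank F)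
∈-stage (atom i) = here refl
∈-stage falsum   = there (here refl)
∈-stage (A ∧' B) = ∈-stage-compound (here refl) (∈-stage A) (∈-stage B)
∈-stage (A ∨' B) = ∈-stage-compound (there (here refl)) (∈-stage A) (∈-stage B)
∈-stage (A ⇒ B)  = ∈-stage-compound (there (there (here refl))) (∈-stage A) (∈-stage B)
∈-stage (A ▷ B)  = ∈-stage-compound (there (there (there (here refl)))) (∈-stage A) (∈-stage B)

-- Maximal consistent sets

record MCS : Set where
  field
    mem        : Fm → Bool
    closed     : ∀ {F} → (λ G → mem G ≡ true) ⊢ₕ F → mem F ≡ true
    consistent : ¬ mem falsum ≡ true
    complete   : ∀ F → mem F ≡ true ⊎ mem (¬' F) ≡ true

infix 4 _∋_
_∋_ : MCS → Fm → Set
Y ∋ F = MCS.mem Y F ≡ true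

module _ (Y : MCS) where
  open MCS Y

  ∋-theorem : ⊢ F → Y ∋ F
  ∋-theorem p = closed (⊢ₕ-theorem p)

  ∋-mp : Y ∋ (A ⇒ B) → Y ∋ A → Y ∋ B
  ∋-mp a⇒b a = closed (⊢ₕ-mp (⊢ₕ-hyp a⇒b) (⊢ₕ-hyp a))

  ∋-by : ⊢ (A ⇒ B) → Y ∋ A → Y ∋ B
  ∋-by p = ∋-mp (∋-theorem p)

  ∋-by₂ : ⊢ (A ⇒ B ⇒ C) → Y ∋ A → Y ∋ B → Y ∋ C
  ∋-by₂ p a b = ∋-mp (∋-by p a) b

  ∋-stable : ¬ ¬ Y ∋ A → Y ∋ A
  ∋-stable {A} ¬¬A with complete A
  ... | inj₁ a  = a
  ... | inj₂ ¬a = ⊥-elim (¬¬A (consistent ∘ ∋-mp ¬a))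

  ∋-∧⁺ : Y ∋ A → Y ∋ B → Y ∋ (A ∧' B)
  ∋-∧⁺ {A} {B} = ∋-by₂ (tautology (`A ⇒ˢ `B ⇒ˢ `A ∧ˢ `B) (A ∷ B ∷ []))

  ∋-∧⁻ : Y ∋ (A ∧' B) → Y ∋ A × Y ∋ B
  ∋-∧⁻ {A} {B} a∧b = ∋-by (tautology (`A ∧ˢ `B ⇒ˢ `A) (A ∷ B ∷ [])) a∧b
                   , ∋-by (tautology (`A ∧ˢ `B ⇒ˢ `B) (A ∷ B ∷ [])) a∧b

  ∋-∨⁺ : Y ∋ A ⊎ Y ∋ B → Y ∋ (A ∨' B)
  ∋-∨⁺ {A} {B} (inj₁ a) = ∋-by (tautology (`A ⇒ˢ `A ∨ˢ `B) (A ∷ B ∷ [])) a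
  ∋-∨⁺ {A} {B} (inj₂ b) = ∋-by (tautology (`B ⇒ˢ `A ∨ˢ `B) (A ∷ B ∷ [])) b

  ∋-∨⁻ : Y ∋ (A ∨' B) → Y ∋ A ⊎ Y ∋ B
  ∋-∨⁻ {A} {B} a∨b with complete A
  ... | inj₁ a  = inj₁ a
  ... | inj₂ ¬a = inj₂ (∋-by₂ (tautology (`A ∨ˢ `B ⇒ˢ ¬ˢ `A ⇒ˢ `B) (A ∷ B ∷ [])) a∨b ¬a)

  ∋-⇒⁺ : (Y ∋ A → Y ∋ B) → Y ∋ (A ⇒ B)
  ∋-⇒⁺ {A} {B} f with complete A
  ... | inj₁ a  = ∋-by (tautology (`B ⇒ˢ `A ⇒ˢ `B) (A ∷ B ∷ [])) (f a)
  ... | inj₂ ¬a = ∋-by (tautology (¬ˢ `A ⇒ˢ `A ⇒ˢ `B) (A ∷ B ∷ [])) ¬a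

-- Lindenbaum's lemma

Decides : Pred Fm 0ℓ → Fm → Set
Decides Γ H = Γ H ⊎ Γ (¬' H)

module Completeness (em : ExcludedMiddle 0ℓ) where

  χ : {X : Set} → Pred X 0ℓ → X → Bool
  χ P x = does (em {P x})

  χ-intro : {X : Set} (P : Pred X 0ℓ) {x : X} → P x → χ P x ≡ true
  χ-intro P = dec-true em

  χ-elim : {X : Set} (P : Pred X 0ℓ) {x : X} → χ P x ≡ true → P x
  χ-elim P {x} χPx with em {P x}
  ... | yes Px = Px

  module Lindenbaum (Δ : Pred Fm 0ℓ) (F₀ : Fm) (Δ⊬F₀ : ¬ Δ ⊢ₕ F₀) where

    decide : (Γ : Pred Fm 0ℓ) (H : Fm) → Dec (Γ ∪ ｛ H ｝ ⊢ₕ F₀) → Pred Fm 0ℓ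
    decide Γ H (yes _) = Γ ∪ ｛ ¬' H ｝
    decide Γ H (no _)  = Γ ∪ ｛ H ｝

    decide-⊬ : ¬ Γ ⊢ₕ F₀ → ∀ d → ¬ decide Γ H d ⊢ₕ F₀
    decide-⊬ Γ⊬F₀ (yes H⊢F₀) ¬H⊢F₀ = Γ⊬F₀ (⊢ₕ-cases H⊢F₀ ¬H⊢F₀)
    decide-⊬ Γ⊬F₀ (no H⊬F₀)  H⊢F₀  = H⊬F₀ H⊢F₀

    decide-⊇ : ∀ d → Γ ⊆ decide Γ H d
    decide-⊇ (yes _) = inj₁
    decide-⊇ (no _)  = inj₁

    decide-decides : ∀ d → Decides (decide Γ H d) H
    decide-decides (yes _) = inj₂ (inj₂ refl)
    decide-decides (no _)  = inj₁ (inj₂ refl)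

    extend : Pred Fm 0ℓ → List Fm → Pred Fm 0ℓ
    extend Γ []       = Γ
    extend Γ (H ∷ Hs) = extend (decide Γ H em) Hs

    extend-⊬ : ∀ Hs → ¬ Γ ⊢ₕ F₀ → ¬ extend Γ Hs ⊢ₕ F₀
    extend-⊬ []       Γ⊬F₀ = Γ⊬F₀
    extend-⊬ (H ∷ Hs) Γ⊬F₀ = extend-⊬ Hs (decide-⊬ Γ⊬F₀ em)

    extend-⊇ : ∀ Hs → Γ ⊆ extend Γ Hs
    extend-⊇ []       = Function.id
    extend-⊇ (H ∷ Hs) = extend-⊇ Hs ∘ decide-⊇ em

    extend-decides : ∀ {Hs} → H ∈ Hs → Decides (extend Γ Hs) H
    extend-decides {Hs = _ ∷ Hs} (here refl) = ⊎-map (extend-⊇ Hs) (extend-⊇ Hs) (decide-decides em)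
    extend-decides (there H∈Hs) = extend-decides H∈Hs

    chain : ℕ → Pred Fm 0ℓ
    chain zero    = Δ
    chain (suc n) = extend (chain n) (stage n)

    chain-⊬ : ∀ n → ¬ chain n ⊢ₕ F₀
    chain-⊬ zero    = Δ⊬F₀
    chain-⊬ (suc n) = extend-⊬ (stage n) (chain-⊬ n)

    chain-step : ∀ n → chain n ⊆ chain (suc n)
    chain-step n = extend-⊇ (stage n)

    ⋃chain : Pred Fm 0ℓ
    ⋃chain G = Σ ℕ λ n → chain n G

    ⋃chain-⊬ : ¬ ⋃chain ⊢ₕ F₀
    ⋃chain-⊬ (L , Gs , p) = let N , Gs′ = chain-bound chain chain-step Gs in chain-⊬ N (L , Gs′ , p)

    ⋃chain-decides : ∀ F → Decides ⋃chain F
    ⋃chain-decides F = ⊎-map (suc (rank F) ,_) (suc (rank F) ,_) (extend-decides (∈-stage F))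

    ⋃chain-⊢ₕ-closed : ⋃chain ⊢ₕ F → ⋃chain F
    ⋃chain-⊢ₕ-closed {F} ⊢F with ⋃chain-decides F
    ... | inj₁ F∈  = F∈
    ... | inj₂ ¬F∈ =
      ⊥-elim (⋃chain-⊬ (⊢ₕ-mp (⊢ₕ-mp (⊢ₕ-theorem (tautology (`A ⇒ˢ ¬ˢ `A ⇒ˢ `B) (F ∷ F₀ ∷ []))) ⊢F)
                              (⊢ₕ-hyp ¬F∈)))

    maximal : MCS
    maximal = record
      { mem        = χ ⋃chain
      ; closed     = χ-intro ⋃chain ∘ ⋃chain-⊢ₕ-closed ∘ ⊢ₕ-mono (χ-elim ⋃chain)
      ; consistent = λ ⊥∈ → ⋃chain-⊬ (⊢ₕ-mp (⊢ₕ-theorem (tautology (⊥ˢ ⇒ˢ `A) (F₀ ∷ [])))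
                                           (⊢ₕ-hyp (χ-elim ⋃chain ⊥∈)))
      ; complete   = λ F → ⊎-map (χ-intro ⋃chain) (χ-intro ⋃chain) (⋃chain-decides F)
      }

  lindenbaum : (Δ : Pred Fm 0ℓ) → ¬ Δ ⊢ₕ F → Σ MCS λ Y → Δ ⊆ (Y ∋_) × ¬ Y ∋ F
  lindenbaum Δ Δ⊬F = maximal , χ-intro ⋃chain ∘ (0 ,_) , λ F∈ → ⋃chain-⊬ (⊢ₕ-hyp (χ-elim ⋃chain F∈))
    where open Lindenbaum Δ _ Δ⊬F

  -- Preferential reasoning inside a maximal consistent set

  module Preferential (X : MCS) where

    infix 4 _|~_ _⊑_

    _|~_ : Fm → Fm → Set
    A |~ B = X ∋ (A ▷ B)

    |~-refl : A |~ A
    |~-refl = ∋-theorem X id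

    |~-lle : ⊢ (A ⇔ B) → A |~ C → B |~ C
    |~-lle {A} {B} {C} A⇔B = ∋-by X (mp (tautology ((`A ⇔ˢ `B) ⇒ˢ `A ⇒ˢ `B) (A ▷ C ∷ B ▷ C ∷ [])) (rcea A⇔B))

    |~-rw : ⊢ (A ⇒ B) → C |~ A → C |~ B
    |~-rw A⇒B = ∋-by X (rck A⇒B)

    |~-and : A |~ B → A |~ C → A |~ (B ∧' C)
    |~-and p q = ∋-mp X (∋-theorem X r-and) (∋-∧⁺ X p q)

    |~-cm : A |~ B → A |~ C → (A ∧' B) |~ C
    |~-cm p q = ∋-mp X (∋-theorem X cm) (∋-∧⁺ X p q)

    |~-or : A |~ C → B |~ C → (A ∨' B) |~ C
    |~-or p q = ∋-mp X (∋-theorem X or) (∋-∧⁺ X p q)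

    |~-⋀ : ∀ {L} → All (A |~_) L → A |~ ⋀ L
    |~-⋀ {A} []       = |~-rw (tautology (`A ⇒ˢ ⊤ˢ) (A ∷ [])) |~-refl
    |~-⋀     (p ∷ ps) = |~-and p (|~-⋀ ps)

    -- Derived from (OR), since B is equivalent to A ∨ (B ∧ ¬A) when A implies B.
    |~-shift : ⊢ (A ⇒ B) → A |~ C → B |~ (A ⇒ C)
    |~-shift {A} {B} {C} A⇒B p =
      |~-lle (mp (tautology ((`A ⇒ˢ `B) ⇒ˢ (`A ∨ˢ `B ∧ˢ ¬ˢ `A ⇔ˢ `B)) (A ∷ B ∷ [])) A⇒B)
        (|~-or (|~-rw (tautology (`C ⇒ˢ `A ⇒ˢ `C) (A ∷ B ∷ C ∷ [])) p)
               (|~-rw (tautology (`B ∧ˢ ¬ˢ `A ⇒ˢ `A ⇒ˢ `C) (A ∷ B ∷ C ∷ [])) |~-refl))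

    |~-cut : A |~ B → (A ∧' B) |~ C → A |~ C
    |~-cut {A} {B} {C} p q =
      |~-rw (tautology (`A ∧ˢ `B ∧ˢ (`A ∧ˢ `B ⇒ˢ `C) ⇒ˢ `C) (A ∷ B ∷ C ∷ []))
        (|~-and |~-refl (|~-and p (|~-shift (tautology (`A ∧ˢ `B ⇒ˢ `A) (A ∷ B ∷ [])) q)))

    -- A ⊑ B: A is at least as normal as B.
    _⊑_ : Fm → Fm → Set
    A ⊑ B = (A ∨' B) |~ A

    module _ (A⊑B : A ⊑ B) (B⊑C : B ⊑ C) where
      private
        ∨₃-|~-A∨B : ((A ∨' B) ∨' C) |~ (A ∨' B)
        ∨₃-|~-A∨B = |~-lle (tautology ((`A ∨ˢ `B) ∨ˢ (`B ∨ˢ `C) ⇔ˢ (`A ∨ˢ `B) ∨ˢ `C) (A ∷ B ∷ C ∷ []))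
                      (|~-or |~-refl (|~-rw (tautology (`B ⇒ˢ `A ∨ˢ `B) (A ∷ B ∷ [])) B⊑C))

        ∨₃-|~-A : ((A ∨' B) ∨' C) |~ A
        ∨₃-|~-A = |~-cut ∨₃-|~-A∨B
                    (|~-lle (tautology (`A ∨ˢ `B ⇔ˢ ((`A ∨ˢ `B) ∨ˢ `C) ∧ˢ (`A ∨ˢ `B)) (A ∷ B ∷ C ∷ [])) A⊑B)

      ⊑-trans : A ⊑ C
      ⊑-trans = |~-lle (tautology (((`A ∨ˢ `B) ∨ˢ `C) ∧ˢ (`A ∨ˢ `C) ⇔ˢ `A ∨ˢ `C) (A ∷ B ∷ C ∷ []))
                  (|~-cm (|~-rw (tautology (`A ⇒ˢ `A ∨ˢ `C) (A ∷ B ∷ C ∷ [])) ∨₃-|~-A) ∨₃-|~-A)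

      ⊑-trans-|~ : A |~ (C ⇒ B)
      ⊑-trans-|~ =
        |~-lle (tautology (((`A ∨ˢ `B) ∨ˢ `C) ∧ˢ `A ⇔ˢ `A) (A ∷ B ∷ C ∷ []))
          (|~-cm ∨₃-|~-A
                 (|~-rw (tautology ((`B ∨ˢ `C ⇒ˢ `B) ⇒ˢ `C ⇒ˢ `B) (A ∷ B ∷ C ∷ []))
                        (|~-shift (tautology (`B ∨ˢ `C ⇒ˢ (`A ∨ˢ `B) ∨ˢ `C) (A ∷ B ∷ C ∷ [])) B⊑C)))

    Normal : Fm → MCS → Set
    Normal A Y = ∀ {B} → A |~ B → Y ∋ B

    normal-∋ : ∀ {Y} → Normal A Y → Y ∋ A
    normal-∋ n = n |~-refl

    normal-countermodel : ¬ A |~ B → Σ MCS λ Y → Normal A Y × ¬ Y ∋ B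
    normal-countermodel {A} ¬A|~B =
      lindenbaum (A |~_) λ (L , ps , ⋀L⇒B) → ¬A|~B (|~-rw ⋀L⇒B (|~-⋀ ps))

    |~-from-normal : (∀ Y → Normal A Y → Y ∋ B) → A |~ B
    |~-from-normal h = ∋-stable X λ ¬A|~B →
      let Y , n , B∉Y = normal-countermodel ¬A|~B in B∉Y (h Y n)

  -- The canonical model

  record World : Set where
    constructor ⟨_,_⟩
    field
      theory  : MCS
      formula : Fm
  open World

  module Canonical (X : MCS) where
    open Preferential X

    IsNormal : World → Set
    IsNormal v = Normal (formula v) (theory v)

    infix 4 _≺_ _≼_

    record _≺_ (v u : World) : Set where
      constructor mk≺
      field
        formula-⊑ : formula v ⊑ formula u
        formula-∉ : ¬ theory v ∋ formula u

    data _≼_ (v : World) : World → Set where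
      ≼-refl : v ≼ v
      ≺⇒≼    : ∀ {u} → v ≺ u → v ≼ u

    ≺-trans : ∀ {v′ v u} → IsNormal v′ → v′ ≺ v → v ≺ u → v′ ≺ u
    ≺-trans {v′} n (mk≺ A⊑B B∉v′) (mk≺ B⊑C _) =
      mk≺ (⊑-trans A⊑B B⊑C) λ C∈v′ → B∉v′ (∋-mp (theory v′) (n (⊑-trans-|~ A⊑B B⊑C)) C∈v′)

    ≼-≺-trans : ∀ {v′ v u} → IsNormal v′ → v′ ≼ v → v ≺ u → v′ ≺ u
    ≼-≺-trans n ≼-refl       v≺u = v≺u
    ≼-≺-trans n (≺⇒≼ v′≺v) v≺u = ≺-trans n v′≺v v≺u

    ≼-trans : ∀ {v′ v u} → IsNormal v′ → v′ ≼ v → v ≼ u → v′ ≼ u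
    ≼-trans n v′≼v ≼-refl      = v′≼v
    ≼-trans n v′≼v (≺⇒≼ v≺u) = ≺⇒≼ (≼-≺-trans n v′≼v v≺u)

    Cone : World → Pred World 0ℓ
    Cone u v = IsNormal v × v ≼ u

    cone-apex : ∀ {u} → IsNormal u → Cone u u
    cone-apex n = n , ≼-refl

    χ-cone-apex : ∀ {u} → IsNormal u → χ (Cone u) u ≡ true
    χ-cone-apex n = χ-intro (Cone _) (cone-apex n)

    cone-apex-unique : ∀ {u v y} → Cone u v → Cone v y → theory y ∋ formula u → v ≡ u
    cone-apex-unique (_ , ≼-refl)    _          _    = refl
    cone-apex-unique (_ , ≺⇒≼ v≺u) (n , y≼v) u∈y = ⊥-elim (_≺_.formula-∉ (≼-≺-trans n y≼v v≺u) u∈y)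

    IsCone : (World → Bool) → Set
    IsCone α = Σ World λ u → IsNormal u × α ≗ χ (Cone u)

    cone-⊆ : ∀ {u v} → Cone u v → Cone v ⊆ Cone u
    cone-⊆ (_ , v≼u) (n , y≼v) = n , ≼-trans n y≼v v≼u

    -- With E = formula y, v is a normal (E ∨ C)-world containing C but not E if there is one;
    -- otherwise E ⊑ C, and v = y works.
    C▷D-witness : ∀ {C D u y} → C |~ D → Cone u y → theory y ∋ C →
                  Σ World λ v → Cone u v × theory v ∋ C × (∀ {v′} → Cone v v′ → theory v′ ∋ (C ⇒ D))
    C▷D-witness {C} {D} {u} {y} C|~D y∈ C∈y
      with em {Σ MCS λ Z → Normal (formula y ∨' C) Z × Z ∋ C × ¬ Z ∋ formula y}
    ... | yes (Z , n , C∈Z , E∉Z) =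
      ⟨ Z , E ∨' C ⟩ , cone-⊆ y∈ (n , ≺⇒≼ v≺y) , C∈Z , C⇒D-below
      where
      E = formula y
      v≺y : ⟨ Z , E ∨' C ⟩ ≺ y
      v≺y = mk≺ (|~-rw (tautology ((`A ∨ˢ `B) ∨ˢ `A ⇒ˢ `A ∨ˢ `B) (E ∷ C ∷ [])) |~-refl) E∉Z
      C⇒D-below : ∀ {v′} → Cone ⟨ Z , E ∨' C ⟩ v′ → theory v′ ∋ (C ⇒ D)
      C⇒D-below {v′} (_ , ≺⇒≼ (mk≺ _ E∨C∉v′)) =
        ∋-⇒⁺ (theory v′) λ C∈v′ → ⊥-elim (E∨C∉v′ (∋-∨⁺ (theory v′) (inj₂ C∈v′)))
      C⇒D-below (_ , ≼-refl) = n (|~-shift (tautology (`A ⇒ˢ `B ∨ˢ `A) (C ∷ E ∷ [])) C|~D)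
    ... | no ∄Z = y , y∈ , C∈y , C⇒D-below
      where
      E = formula y
      E⊑C : E ⊑ C
      E⊑C = |~-rw (tautology ((`A ∨ˢ `B) ∧ˢ (`B ⇒ˢ `A) ⇒ˢ `A) (E ∷ C ∷ []))
              (|~-and |~-refl (|~-from-normal λ Z n →
                 ∋-⇒⁺ Z λ C∈Z → ∋-stable Z λ E∉Z → ∄Z (Z , n , C∈Z , E∉Z)))
      E|~C⇒D : E |~ (C ⇒ D)
      E|~C⇒D = |~-lle (tautology ((`A ∨ˢ `B) ∧ˢ `A ⇔ˢ `A) (E ∷ C ∷ []))
                 (|~-cm E⊑C (|~-shift (tautology (`A ⇒ˢ `B ∨ˢ `A) (C ∷ E ∷ [])) C|~D))
      C⇒D-below : ∀ {v′} → Cone y v′ → theory v′ ∋ (C ⇒ D)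
      C⇒D-below {v′} (n , ≺⇒≼ (mk≺ G⊑E E∉v′)) =
        ∋-⇒⁺ (theory v′) λ C∈v′ → ⊥-elim (E∉v′ (∋-mp (theory v′) (n (⊑-trans-|~ G⊑E E⊑C)) C∈v′))
      C⇒D-below (_ , ≼-refl) = proj₁ y∈ E|~C⇒D

  canonical : World → Model
  canonical w₀ = record
    { W        = World
    ; w₀       = w₀
    ; N        = Canonical.IsCone ∘ theory
    ; V        = λ w i → theory w ∋ atom i
    ; nonempty = λ { {w} (u , n , α≗) → u , trans (α≗ u) (Canonical.χ-cone-apex (theory w) n) }
    }

  module Truth (w₀ : World) where
    _⊩ᶜ_ : World → Fm → Set
    _⊩ᶜ_ = _⊩_ (canonical w₀)

    module ▷-case {C D : Fm}
      (⊩C⇒∋C : ∀ {w} → w ⊩ᶜ C → theory w ∋ C) (∋C⇒⊩C : ∀ {w} → theory w ∋ C → w ⊩ᶜ C)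
      (⊩D⇒∋D : ∀ {w} → w ⊩ᶜ D → theory w ∋ D) (∋D⇒⊩D : ∀ {w} → theory w ∋ D → w ⊩ᶜ D)
      (w : World) where
      open Preferential (theory w)
      open Canonical (theory w)

      ∋▷⇒⊩▷ : C |~ D → w ⊩ᶜ (C ▷ D)
      ∋▷⇒⊩▷ C|~D α (u , _ , α≗) (y , y∈α , y⊩C)
        with C▷D-witness C|~D (χ-elim (Cone u) (trans (sym (α≗ y)) y∈α)) (⊩C⇒∋C y⊩C)
      ... | v , v∈ , C∈v , C⇒D-below =
        χ (Cone v) , (v , proj₁ v∈ , λ _ → refl) , β⊆α ,
        (v , χ-cone-apex (proj₁ v∈) , ∋C⇒⊩C C∈v) ,
        λ y′ y′∈β y′⊩C → ∋D⇒⊩D (∋-mp (theory y′) (C⇒D-below (χ-elim (Cone v) y′∈β)) (⊩C⇒∋C y′⊩C))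
        where
        β⊆α : ∀ y′ → χ (Cone v) y′ ≡ true → α y′ ≡ true
        β⊆α y′ y′∈β = trans (α≗ y′) (χ-intro (Cone u) (cone-⊆ v∈ (χ-elim (Cone v) y′∈β)))

      -- A sub-cone of the cone of ⟨ Y , C ⟩ containing a C-world has apex ⟨ Y , C ⟩, since C fails
      -- strictly below it.
      ⊩▷⇒∋▷ : w ⊩ᶜ (C ▷ D) → C |~ D
      ⊩▷⇒∋▷ w⊩C▷D = ∋-stable (theory w) refute
        where
        refute : ¬ ¬ C |~ D
        refute ¬C|~D with normal-countermodel ¬C|~D
        ... | Y , n , D∉Y
          with w⊩C▷D (χ (Cone ⟨ Y , C ⟩)) (⟨ Y , C ⟩ , n , λ _ → refl)
                     (⟨ Y , C ⟩ , χ-cone-apex n , ∋C⇒⊩C (normal-∋ {Y = Y} n))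
        ... | β , (v , nv , β≗) , β⊆α , (y , y∈β , y⊩C) , C⇒D-in-β
          with cone-apex-unique (χ-elim (Cone ⟨ Y , C ⟩) (β⊆α v (trans (β≗ v) (χ-cone-apex nv))))
                                (χ-elim (Cone v) (trans (sym (β≗ y)) y∈β)) (⊩C⇒∋C y⊩C)
        ... | refl = D∉Y (⊩D⇒∋D (C⇒D-in-β v (trans (β≗ v) (χ-cone-apex nv)) (∋C⇒⊩C (normal-∋ {Y = Y} n))))

    mutual
      ⊩⇒∋ : ∀ F {w} → w ⊩ᶜ F → theory w ∋ F
      ⊩⇒∋ (atom i)     a       = a
      ⊩⇒∋ falsum       ()
      ⊩⇒∋ (A ∧' B) {w} (a , b) = ∋-∧⁺ (theory w) (⊩⇒∋ A a) (⊩⇒∋ B b)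
      ⊩⇒∋ (A ∨' B) {w} a∨b     = ∋-∨⁺ (theory w) (⊎-map (⊩⇒∋ A) (⊩⇒∋ B) a∨b)
      ⊩⇒∋ (A ⇒ B)  {w} a⇒b     = ∋-⇒⁺ (theory w) (⊩⇒∋ B ∘ a⇒b ∘ ∋⇒⊩ A)
      ⊩⇒∋ (C ▷ D)  {w}         = ▷-case.⊩▷⇒∋▷ (⊩⇒∋ C) (∋⇒⊩ C) (⊩⇒∋ D) (∋⇒⊩ D) w

      ∋⇒⊩ : ∀ F {w} → theory w ∋ F → w ⊩ᶜ F
      ∋⇒⊩ (atom i)     a   = a
      ∋⇒⊩ falsum   {w} ⊥∈  = MCS.consistent (theory w) ⊥∈
      ∋⇒⊩ (A ∧' B) {w} a∧b = let a , b = ∋-∧⁻ (theory w) a∧b in ∋⇒⊩ A a , ∋⇒⊩ B b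
      ∋⇒⊩ (A ∨' B) {w} a∨b = ⊎-map (∋⇒⊩ A) (∋⇒⊩ B) (∋-∨⁻ (theory w) a∨b)
      ∋⇒⊩ (A ⇒ B)  {w} a⇒b = ∋⇒⊩ B ∘ ∋-mp (theory w) a⇒b ∘ ⊩⇒∋ A
      ∋⇒⊩ (C ▷ D)  {w}     = ▷-case.∋▷⇒⊩▷ (⊩⇒∋ C) (∋⇒⊩ C) (⊩⇒∋ D) (∋⇒⊩ D) w

  completeness : Valid F → ⊢ F
  completeness {F} valid with em {⊢ F}
  ... | yes ⊢F = ⊢F
  ... | no ⊬F  =
    let Y , _ , F∉Y = lindenbaum ∅ (⊬F ∘ ∅-⊢ₕ)
        w = ⟨ Y , F ⟩
    in ⊥-elim (F∉Y (Truth.⊩⇒∋ w F (valid (canonical w) w)))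

mainTheorem2 : (∀ {ℓ} → ExcludedMiddle ℓ) → (F : Fm) → Valid F → ⊢ F
mainTheorem2 em F = Completeness.completeness em
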